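{- Let $n\ge3$ and consider the flipped Penney-Ante game on strings of length $n$. Then there are exactly two optimal strategies for Player I, namely the string $HH\dots H$ consisting of $n$ heads and the string $TT\dots T$ consisting of $n$ tails. Under these strategies, Player I wins with probability $1/2$ (assuming optimal play by Player II).
   Context: Flipped Penney-Ante game with strings of length $n$: Player I chooses a string $A\in\{H,T\}^n$; Player II, seeing $A$, chooses $B\in\{H,T\}^n$, $B\neq A$. A fair coin is tossed repeatedly (independently), and the player whose string appears (as a block of consecutive tosses) last wins, i.e. Player I wins iff $B$ appears before $A$. A string $A$ is an optimal strategy for Player I if it maximizes $\min_{B\ne A}P(B\text{ appears before }A)$ over all $A\in\{H,T\}^n$. -}

module Defs where

open import Data.Bool using (Bool; true; false; if_then_else_)
open import Data.Nat as ℕ using (ℕ; zero; suc)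
open import Data.List using (List; []; _∷_; map; _++_; reverse)
open import Data.Vec using (Vec; toList; replicate)
open import Data.Rational using (ℚ; 0ℚ; 1ℚ; ½; _*_; _-_; ∣_∣; _≤_; _<_; _/_)
open import Data.Integer using (+_)
open import Data.Product using (Σ; ∃-syntax; _×_)
open import Relation.Binary.PropositionalEquality using (_≡_; _≢_)

-- Coin outcomes: true = H (heads), false = T (tails).

isPrefix : List Bool → List Bool → Bool
isPrefix [] _ = true
isPrefix (_ ∷ _) [] = false
isPrefix (true ∷ p) (true ∷ xs) = isPrefix p xs
isPrefix (false ∷ p) (false ∷ xs) = isPrefix p xs
isPrefix (true ∷ p) (false ∷ xs) = false
isPrefix (false ∷ p) (true ∷ xs) = false

-- Scan a toss sequence left to right, keeping the history reversed.  If the tosses run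
-- out before either appears, the result is false.
-- Arguments: rA = reverse A, rB = reverse B.
scan : (rA rB hist tosses : List Bool) → Bool
scan rA rB hist [] = false
scan rA rB hist (t ∷ ts) =
  if isPrefix rA (t ∷ hist) then false
  else if isPrefix rB (t ∷ hist) then true
  else scan rA rB (t ∷ hist) ts

BBeforeA : List Bool → List Bool → List Bool → Bool
BBeforeA A B s = scan (reverse A) (reverse B) [] s

allSeqs : ℕ → List (List Bool)
allSeqs zero = [] ∷ []
allSeqs (suc k) = map (true ∷_) (allSeqs k) ++ map (false ∷_) (allSeqs k)

countTrue : List Bool → ℕ
countTrue [] = 0
countTrue (true ∷ bs) = suc (countTrue bs)
countTrue (false ∷ bs) = countTrue bs

halfPow : ℕ → ℚ
halfPow zero = 1ℚ
halfPow (suc k) = ½ * halfPow k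

probWithin : {n : ℕ} → Vec Bool n → Vec Bool n → ℕ → ℚ
probWithin A B k =
  ((+ countTrue (map (BBeforeA (toList A) (toList B)) (allSeqs k))) / 1) * halfPow k

-- ProbBBeforeA A B q : P(B appears before A) = q, where the probability of
-- the event {B appears before A} is the limit (continuity of measure along
-- the increasing events "decided within k tosses") of probWithin A B k.
ProbBBeforeA : {n : ℕ} → Vec Bool n → Vec Bool n → ℚ → Set
ProbBBeforeA A B q =
  ∀ (ε : ℚ) → 0ℚ < ε → ∃[ K ] (∀ k → K ℕ.≤ k → ∣ probWithin A B k - q ∣ ≤ ε)

-- Value A v : min over B ≠ A of P(B appears before A) equals v
-- (i.e. P(Player I wins with A, against optimal Player II) = v).
Value : {n : ℕ} → Vec Bool n → ℚ → Set
Value {n} A v =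
  (∀ (B : Vec Bool n) → B ≢ A → ∀ q → ProbBBeforeA A B q → v ≤ q)
  × (∃[ B ] (B ≢ A × ProbBBeforeA A B v))

IsOptimal : (n : ℕ) → Vec Bool n → Set
IsOptimal n A = ∃[ v ] (Value A v × (∀ (A' : Vec Bool n) (v' : ℚ) → Value A' v' → v' ≤ v))

allH : (n : ℕ) → Vec Bool n
allH n = replicate n true

allT : (n : ℕ) → Vec Bool n
allT n = replicate n false

module Submission where

-- Conway's martingale argument.  Strings and the toss history are kept reversed, so that
-- X having just appeared reads: reverse X is a prefix of the history.  Gamblers entering
-- before every toss and betting on X form a fair game in which each toss costs 1, so by
-- optional stopping over the 2 ^ k toss sequences of length k, run once for the gamblers
-- on A and once for those on B, the numbers of sequences in which A, resp. B, comes first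
-- satisfy a · #A = b · #B up to the sequences still undecided, where a = AA − BA and
-- b = BB − AB in Conway's correlations.  The undecided sequences are a vanishing fraction,
-- so P(B before A) = a / (a + b).  Comparing correlations termwise, a constant string has
-- a ≥ b against every B, with equality for B = c…c¬c, while against a non-constant A the
-- constant string of A's last letter achieves a < b.

open import Defs
open import Data.Bool using (Bool; true; false; not; if_then_else_)
import Data.Bool.Properties as Bool
open import Data.Nat as ℕ using (ℕ; zero; suc; _+_; _*_; _^_; _∸_; _⊔_; _≤_; _<_; z≤n; s≤s)
open import Data.Nat.Properties
open import Data.Nat.Coprimality using (Coprime)
open import Data.Nat.Tactic.RingSolver using (solve-∀)
open import Data.List as List using (List; []; _∷_; length; replicate; map; _++_)
import Data.List.Properties as List
open import Data.Vec as Vec using (Vec; toList)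
import Data.Vec.Properties as Vec
open import Data.Integer as ℤ using (+_; -[1+_]; _⊖_)
import Data.Integer.Properties as ℤ
open import Data.Rational as ℚ using (ℚ; mkℚ; ½; 0ℚ; 1ℚ; toℚᵘ)
import Data.Rational.Properties as ℚ
open import Data.Rational.Solver using (module +-*-Solver)
open import Data.Rational.Unnormalised as ℚᵘ using (mkℚᵘ; *≤*; *<*; _≃_)
import Data.Rational.Unnormalised.Properties as ℚᵘ
open import Data.Product using (_×_; _,_; ∃-syntax; proj₁)
open import Data.Sum using (_⊎_; inj₁; inj₂; [_,_]′)
open import Function using (_∘_; _⇔_; mk⇔)
open import Relation.Nullary using (¬_; yes; no; contradiction)
open import Relation.Nullary.Decidable using (toWitness)
open import Relation.Binary.PropositionalEquality

isPrefix-refl : ∀ r → isPrefix r r ≡ true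
isPrefix-refl [] = refl
isPrefix-refl (true ∷ r) = isPrefix-refl r
isPrefix-refl (false ∷ r) = isPrefix-refl r

isPrefix⇒≡ : ∀ s g → isPrefix s g ≡ true → length s ≡ length g → s ≡ g
isPrefix⇒≡ [] [] _ _ = refl
isPrefix⇒≡ (true ∷ s) (true ∷ g) p l = cong (true ∷_) (isPrefix⇒≡ s g p (suc-injective l))
isPrefix⇒≡ (false ∷ s) (false ∷ g) p l = cong (false ∷_) (isPrefix⇒≡ s g p (suc-injective l))
isPrefix⇒≡ (true ∷ s) (false ∷ g) () _
isPrefix⇒≡ (false ∷ s) (true ∷ g) () _

isPrefix-replicate⇒≡ : ∀ s n c → isPrefix s (replicate n c) ≡ true → s ≡ replicate (length s) c
isPrefix-replicate⇒≡ [] n c p = refl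
isPrefix-replicate⇒≡ (true ∷ s) (suc n) true p = cong (true ∷_) (isPrefix-replicate⇒≡ s n true p)
isPrefix-replicate⇒≡ (false ∷ s) (suc n) false p = cong (false ∷_) (isPrefix-replicate⇒≡ s n false p)
isPrefix-replicate⇒≡ (true ∷ s) (suc n) false ()
isPrefix-replicate⇒≡ (false ∷ s) (suc n) true ()

replicate-isPrefix : ∀ {m n} c → m ≤ n → isPrefix (replicate m c) (replicate n c) ≡ true
replicate-isPrefix c z≤n = refl
replicate-isPrefix true (s≤s m≤n) = replicate-isPrefix true m≤n
replicate-isPrefix false (s≤s m≤n) = replicate-isPrefix false m≤n

isPrefix-∷⇒≡replicate : ∀ s x → isPrefix s (x ∷ s) ≡ true → s ≡ replicate (length s) x
isPrefix-∷⇒≡replicate [] x p = refl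
isPrefix-∷⇒≡replicate (true ∷ s) true p = cong (true ∷_) (isPrefix-∷⇒≡replicate s true p)
isPrefix-∷⇒≡replicate (false ∷ s) false p = cong (false ∷_) (isPrefix-∷⇒≡replicate s false p)
isPrefix-∷⇒≡replicate (true ∷ s) false ()
isPrefix-∷⇒≡replicate (false ∷ s) true ()

isPrefix-of-prefix : ∀ s g g′ → isPrefix g′ g ≡ true → length s ≤ length g′ → isPrefix s g ≡ isPrefix s g′
isPrefix-of-prefix [] g g′ p l = refl
isPrefix-of-prefix (true ∷ s) (true ∷ g) (true ∷ g′) p (s≤s l) = isPrefix-of-prefix s g g′ p l
isPrefix-of-prefix (false ∷ s) (false ∷ g) (false ∷ g′) p (s≤s l) = isPrefix-of-prefix s g g′ p l
isPrefix-of-prefix (true ∷ s) (false ∷ g) (false ∷ g′) p l = refl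
isPrefix-of-prefix (false ∷ s) (true ∷ g) (true ∷ g′) p l = refl
isPrefix-of-prefix (_ ∷ s) (true ∷ g) (false ∷ g′) () l
isPrefix-of-prefix (_ ∷ s) (false ∷ g) (true ∷ g′) () l

-- Conway's gamblers

infix 7 [_]×_

[_]×_ : Bool → ℕ → ℕ
[ true ]× n = n
[ false ]× n = 0

[]×-≤ : ∀ b n → [ b ]× n ≤ n
[]×-≤ true n = ≤-refl
[]×-≤ false n = z≤n

[]×-*ˡ : ∀ b k n → [ b ]× (k * n) ≡ k * ([ b ]× n)
[]×-*ˡ true k n = refl
[]×-*ˡ false k n = sym (*-zeroʳ k)

-- wealth (reverse X) h is the total fortune, after the reversed history h, of Conway's
-- gamblers on X: one enters before every toss with stake 1 and doubles it while the
-- tosses keep spelling X.  At h = reverse Y it is twice Conway's correlation YX, read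
-- as a binary number.
wealth : List Bool → List Bool → ℕ
wealth [] h = 0
wealth (x ∷ r) h = [ isPrefix (x ∷ r) h ]× 2 ^ suc (length r) + wealth r h

-- The game is fair: a toss raises the average wealth by the new gambler's stake, up to
-- the correction needed when r had already appeared.
wealth-martingale : ∀ r h →
  wealth r (true ∷ h) + wealth r (false ∷ h) + [ isPrefix r h ]× 2 ^ suc (length r) ≡ 2 + 2 * wealth r h
wealth-martingale [] h = refl
wealth-martingale (x ∷ r) h = begin
    (b true + wT) + (b false + wF) + [ isPrefix (x ∷ r) h ]× (2 * m)
      ≡⟨ cong₂ _+_ (regroup (b true) wT (b false) wF) ([]×-*ˡ (isPrefix (x ∷ r) h) 2 m) ⟩
    wT + wF + (b true + b false) + 2 * ([ isPrefix (x ∷ r) h ]× m)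
      ≡⟨ cong (λ z → wT + wF + z + 2 * ([ isPrefix (x ∷ r) h ]× m)) (bonus-split x) ⟩
    wT + wF + [ isPrefix r h ]× m + 2 * ([ isPrefix (x ∷ r) h ]× m)
      ≡⟨ cong (_+ 2 * ([ isPrefix (x ∷ r) h ]× m)) (wealth-martingale r h) ⟩
    2 + 2 * wealth r h + 2 * ([ isPrefix (x ∷ r) h ]× m)
      ≡⟨ collect (wealth r h) ([ isPrefix (x ∷ r) h ]× m) ⟩
    2 + 2 * wealth (x ∷ r) h ∎
  where
  open ≡-Reasoning
  m = 2 ^ suc (length r)
  wT = wealth r (true ∷ h)
  wF = wealth r (false ∷ h)
  b : Bool → ℕ
  b t = [ isPrefix (x ∷ r) (t ∷ h) ]× m
  bonus-split : ∀ x → [ isPrefix (x ∷ r) (true ∷ h) ]× m + [ isPrefix (x ∷ r) (false ∷ h) ]× m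
                      ≡ [ isPrefix r h ]× m
  bonus-split true = +-identityʳ _
  bonus-split false = refl
  regroup : ∀ p u q v → (p + u) + (q + v) ≡ u + v + (p + q)
  regroup = solve-∀
  collect : ∀ w c → 2 + 2 * w + 2 * c ≡ 2 + 2 * (c + w)
  collect = solve-∀

wealth-[] : ∀ r → wealth r [] ≡ 0
wealth-[] [] = refl
wealth-[] (x ∷ r) = wealth-[] r

wealth-of-prefix : ∀ r g g′ → isPrefix g′ g ≡ true → length r ≤ length g′ → wealth r g ≡ wealth r g′
wealth-of-prefix [] g g′ p l = refl
wealth-of-prefix (x ∷ r) g g′ p l =
  cong₂ (λ b w → [ b ]× 2 ^ suc (length r) + w) (isPrefix-of-prefix (x ∷ r) g g′ p l)
        (wealth-of-prefix r g g′ p (≤-trans (n≤1+n _) l))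

wealth-∷-matched : ∀ x s g → isPrefix (x ∷ s) g ≡ true → wealth (x ∷ s) g ≡ 2 ^ suc (length s) + wealth s g
wealth-∷-matched x s g matched = cong (λ b → [ b ]× 2 ^ suc (length s) + wealth s g) matched

wealth-∷-unmatched : ∀ x s g → isPrefix (x ∷ s) g ≡ false → wealth (x ∷ s) g ≡ wealth s g
wealth-∷-unmatched x s g unmatched = cong (λ b → [ b ]× 2 ^ suc (length s) + wealth s g) unmatched

2+wealth≤ : ∀ r g → 2 + wealth r g ≤ 2 ^ suc (length r)
2+wealth≤ [] g = ≤-refl
2+wealth≤ (x ∷ r) g = begin
    2 + ([ isPrefix (x ∷ r) g ]× m + wealth r g) ≡⟨ swap ([ isPrefix (x ∷ r) g ]× m) (wealth r g) ⟩
    [ isPrefix (x ∷ r) g ]× m + (2 + wealth r g) ≤⟨ +-mono-≤ ([]×-≤ (isPrefix (x ∷ r) g) m) (2+wealth≤ r g) ⟩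
    m + m ≡⟨ cong (λ z → m + z) (sym (+-identityʳ m)) ⟩
    2 ^ suc (length (x ∷ r)) ∎
  where
  open ≤-Reasoning
  m = 2 ^ suc (length r)
  swap : ∀ p w → 2 + (p + w) ≡ p + (2 + w)
  swap = solve-∀

wealth≤ : ∀ r g → wealth r g ≤ 2 ^ suc (length r)
wealth≤ r g = m+n≤o⇒n≤o 2 (2+wealth≤ r g)

wealth-cross<wealth-self : ∀ r s → length s ≡ length r → s ≢ r → wealth s r < wealth r r
wealth-cross<wealth-self [] [] _ s≢r = contradiction refl s≢r
wealth-cross<wealth-self (x ∷ r) (y ∷ s) l s≢r
  rewrite isPrefix-refl (x ∷ r)
        | Bool.¬-not {isPrefix (y ∷ s) (x ∷ r)} (λ p → s≢r (isPrefix⇒≡ (y ∷ s) (x ∷ r) p l)) = begin-strict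
    wealth s (x ∷ r)    <⟨ m+n≤o⇒n≤o 1 (2+wealth≤ s (x ∷ r)) ⟩
    2 ^ suc (length s)  ≡⟨ cong (λ z → 2 ^ suc z) (suc-injective l) ⟩
    2 ^ suc (length r)  ≤⟨ m≤m+n _ _ ⟩
    2 ^ suc (length r) + wealth r (x ∷ r) ∎
  where open ≤-Reasoning

outcome : Bool → Bool → ℕ → ℕ → ℕ → ℕ
outcome true _ x y z = x
outcome false true x y z = y
outcome false false x y z = z

countTrue-++ : ∀ xs ys → countTrue (xs ++ ys) ≡ countTrue xs + countTrue ys
countTrue-++ [] ys = refl
countTrue-++ (true ∷ xs) ys = cong suc (countTrue-++ xs ys)
countTrue-++ (false ∷ xs) ys = countTrue-++ xs ys

length-allSeqs : ∀ k → length (allSeqs k) ≡ 2 ^ k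
length-allSeqs zero = refl
length-allSeqs (suc k) = begin
    length (map (true ∷_) S ++ map (false ∷_) S)         ≡⟨ List.length-++ (map (true ∷_) S) ⟩
    length (map (true ∷_) S) + length (map (false ∷_) S) ≡⟨ cong₂ _+_ (List.length-map _ S) (List.length-map _ S) ⟩
    length S + length S                                  ≡⟨ cong (λ z → z + z) (length-allSeqs k) ⟩
    2 ^ k + 2 ^ k                                        ≡⟨ cong (λ z → 2 ^ k + z) (sym (+-identityʳ (2 ^ k))) ⟩
    2 ^ suc k ∎
  where
  open ≡-Reasoning
  S = allSeqs k

countTrue-if : ∀ pa pb (f : List Bool → Bool) S →
  countTrue (map (λ s → if pa then false else (if pb then true else f s)) S)
  ≡ outcome pa pb (length S * 0) (length S * 1) (countTrue (map f S))
countTrue-if true pb f S = count-false S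
  where
  count-false : ∀ (S : List (List Bool)) → countTrue (map (λ _ → false) S) ≡ length S * 0
  count-false [] = refl
  count-false (_ ∷ S) = count-false S
countTrue-if false true f S = count-true S
  where
  count-true : ∀ (S : List (List Bool)) → countTrue (map (λ _ → true) S) ≡ length S * 1
  count-true [] = refl
  count-true (_ ∷ S) = cong suc (count-true S)
countTrue-if false false f S = refl

module FirstToAppear (rA rB : List Bool) where

  -- sumPayoff va vb vu k h sums over the 2 ^ k ways of continuing the history h by k
  -- tosses: va if A appears first, vb if B does, vu of the final history if neither.
  -- A continuation decided with j tosses to spare stands for 2 ^ j of them.
  mutual
    sumPayoff : ℕ → ℕ → (List Bool → ℕ) → ℕ → List Bool → ℕ
    sumPayoff va vb vu zero h = vu h
    sumPayoff va vb vu (suc k) h = afterToss va vb vu k h true + afterToss va vb vu k h false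

    afterToss : ℕ → ℕ → (List Bool → ℕ) → ℕ → List Bool → Bool → ℕ
    afterToss va vb vu k h t =
      outcome (isPrefix rA (t ∷ h)) (isPrefix rB (t ∷ h)) (2 ^ k * va) (2 ^ k * vb) (sumPayoff va vb vu k (t ∷ h))

  -- Summed over the same continuations: the number of tosses made before the game stops.
  mutual
    duration : ℕ → List Bool → ℕ
    duration zero h = 0
    duration (suc k) h = 2 ^ suc k + durationAfter k h true + durationAfter k h false

    durationAfter : ℕ → List Bool → Bool → ℕ
    durationAfter k h t = outcome (isPrefix rA (t ∷ h)) (isPrefix rB (t ∷ h)) 0 0 (duration k (t ∷ h))

  #A #B #open : ℕ → List Bool → ℕ
  #A = sumPayoff 1 0 (λ _ → 0)
  #B = sumPayoff 0 1 (λ _ → 0)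
  #open = sumPayoff 0 0 (λ _ → 1)

  sumPayoff-linear : ∀ va vb vu k h → sumPayoff va vb vu k h ≡ va * #A k h + vb * #B k h + sumPayoff 0 0 vu k h
  sumPayoff-linear va vb vu zero h = cong (_+ vu h) (sym (cong₂ _+_ (*-zeroʳ va) (*-zeroʳ vb)))
  sumPayoff-linear va vb vu (suc k) h = begin
      afterToss va vb vu k h true + afterToss va vb vu k h false
        ≡⟨ cong₂ _+_ (perToss true) (perToss false) ⟩
      (va * a true + vb * b true + r true) + (va * a false + vb * b false + r false)
        ≡⟨ regroup va vb (a true) (b true) (r true) (a false) (b false) (r false) ⟩
      va * #A (suc k) h + vb * #B (suc k) h + sumPayoff 0 0 vu (suc k) h ∎
    where
    open ≡-Reasoning
    a b r : Bool → ℕ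
    a = afterToss 1 0 (λ _ → 0) k h
    b = afterToss 0 1 (λ _ → 0) k h
    r = afterToss 0 0 vu k h
    regroup : ∀ va vb a₁ b₁ r₁ a₂ b₂ r₂ → (va * a₁ + vb * b₁ + r₁) + (va * a₂ + vb * b₂ + r₂)
                                          ≡ va * (a₁ + a₂) + vb * (b₁ + b₂) + (r₁ + r₂)
    regroup = solve-∀
    perToss : ∀ t → afterToss va vb vu k h t ≡ va * a t + vb * b t + r t
    perToss t with isPrefix rA (t ∷ h) | isPrefix rB (t ∷ h)
    ... | true | _ = A-wins (2 ^ k) va vb
      where A-wins : ∀ p va vb → p * va ≡ va * (p * 1) + vb * (p * 0) + p * 0
            A-wins = solve-∀
    ... | false | true = B-wins (2 ^ k) va vb
      where B-wins : ∀ p va vb → p * vb ≡ va * (p * 0) + vb * (p * 1) + p * 0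
            B-wins = solve-∀
    ... | false | false = sumPayoff-linear va vb vu k (t ∷ h)

  #A+#B+#open : ∀ k h → #A k h + #B k h + #open k h ≡ 2 ^ k
  #A+#B+#open zero h = refl
  #A+#B+#open (suc k) h = begin
      (a true + a false) + (b true + b false) + (u true + u false)
        ≡⟨ regroup (a true) (a false) (b true) (b false) (u true) (u false) ⟩
      (a true + b true + u true) + (a false + b false + u false)
        ≡⟨ cong₂ _+_ (perToss true) (perToss false) ⟩
      2 ^ k + 2 ^ k ≡⟨ cong (λ z → 2 ^ k + z) (sym (+-identityʳ (2 ^ k))) ⟩
      2 ^ suc k ∎
    where
    open ≡-Reasoning
    a b u : Bool → ℕ
    a = afterToss 1 0 (λ _ → 0) k h
    b = afterToss 0 1 (λ _ → 0) k h
    u = afterToss 0 0 (λ _ → 1) k h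
    regroup : ∀ a₁ a₂ b₁ b₂ u₁ u₂ → (a₁ + a₂) + (b₁ + b₂) + (u₁ + u₂) ≡ (a₁ + b₁ + u₁) + (a₂ + b₂ + u₂)
    regroup = solve-∀
    perToss : ∀ t → a t + b t + u t ≡ 2 ^ k
    perToss t with isPrefix rA (t ∷ h) | isPrefix rB (t ∷ h)
    ... | true | _ = A-wins (2 ^ k)
      where A-wins : ∀ p → p * 1 + p * 0 + p * 0 ≡ p
            A-wins = solve-∀
    ... | false | true = B-wins (2 ^ k)
      where B-wins : ∀ p → p * 0 + p * 1 + p * 0 ≡ p
            B-wins = solve-∀
    ... | false | false = #A+#B+#open k (t ∷ h)

  -- Optional stopping for the gamblers on X, X one of the two strings: the gamblers' final
  -- wealth, summed over all continuations, is their present wealth plus the tosses paid for.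
  optional-stopping : ∀ rX → (rX ≡ rA ⊎ rX ≡ rB) → length rX ≤ length rA → length rX ≤ length rB →
    ∀ k h → isPrefix rA h ≡ false → isPrefix rB h ≡ false →
    sumPayoff (wealth rX rA) (wealth rX rB) (wealth rX) k h ≡ 2 ^ k * wealth rX h + duration k h
  optional-stopping rX rX∈ |rX|≤|rA| |rX|≤|rB| zero h _ _ = sym (trans (+-identityʳ _) (*-identityˡ _))
  optional-stopping rX rX∈ |rX|≤|rA| |rX|≤|rB| (suc k) h A∉h B∉h = begin
      afterToss vA vB (wealth rX) k h true + afterToss vA vB (wealth rX) k h false
        ≡⟨ cong₂ _+_ (perToss true) (perToss false) ⟩
      (p * wealth rX (true ∷ h) + d true) + (p * wealth rX (false ∷ h) + d false)
        ≡⟨ regroup p (wealth rX (true ∷ h)) (wealth rX (false ∷ h)) (d true) (d false) ⟩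
      p * (wealth rX (true ∷ h) + wealth rX (false ∷ h) + 0) + (d true + d false)
        ≡⟨ cong (λ b → p * (wealth rX (true ∷ h) + wealth rX (false ∷ h) + [ b ]× 2 ^ suc (length rX)) + (d true + d false))
                (sym X∉h) ⟩
      p * (wealth rX (true ∷ h) + wealth rX (false ∷ h) + [ isPrefix rX h ]× 2 ^ suc (length rX)) + (d true + d false)
        ≡⟨ cong (λ z → p * z + (d true + d false)) (wealth-martingale rX h) ⟩
      p * (2 + 2 * wealth rX h) + (d true + d false)
        ≡⟨ collect p (wealth rX h) (d true) (d false) ⟩
      2 ^ suc k * wealth rX h + duration (suc k) h ∎
    where
    open ≡-Reasoning
    vA = wealth rX rA
    vB = wealth rX rB
    p = 2 ^ k
    X∉h : isPrefix rX h ≡ false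
    X∉h = [ (λ X≡A → trans (cong (λ r → isPrefix r h) X≡A) A∉h)
          , (λ X≡B → trans (cong (λ r → isPrefix r h) X≡B) B∉h) ]′ rX∈
    d : Bool → ℕ
    d = durationAfter k h
    regroup : ∀ p u v c d → (p * u + c) + (p * v + d) ≡ p * (u + v + 0) + (c + d)
    regroup = solve-∀
    collect : ∀ p w c d → p * (2 + 2 * w) + (c + d) ≡ (2 * p) * w + ((2 * p) + c + d)
    collect = solve-∀
    perToss : ∀ t → afterToss vA vB (wealth rX) k h t ≡ p * wealth rX (t ∷ h) + d t
    perToss t with isPrefix rA (t ∷ h) in A∈ | isPrefix rB (t ∷ h) in B∈
    ... | true | _ = trans (cong (p *_) (sym (wealth-of-prefix rX (t ∷ h) rA A∈ |rX|≤|rA|))) (sym (+-identityʳ _))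
    ... | false | true = trans (cong (p *_) (sym (wealth-of-prefix rX (t ∷ h) rB B∈ |rX|≤|rB|))) (sym (+-identityʳ _))
    ... | false | false = optional-stopping rX rX∈ |rX|≤|rA| |rX|≤|rB| k (t ∷ h) A∈ B∈

  sumPayoff≤ : ∀ M va vb vu → va ≤ M → vb ≤ M → (∀ g → vu g ≤ M) → ∀ k h → sumPayoff va vb vu k h ≤ 2 ^ k * M
  sumPayoff≤ M va vb vu va≤M vb≤M vu≤M zero h = ≤-trans (vu≤M h) (≤-reflexive (sym (*-identityˡ M)))
  sumPayoff≤ M va vb vu va≤M vb≤M vu≤M (suc k) h = begin
      afterToss va vb vu k h true + afterToss va vb vu k h false ≤⟨ +-mono-≤ (perToss true) (perToss false) ⟩
      2 ^ k * M + 2 ^ k * M                                    ≡⟨ double (2 ^ k) M ⟩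
      2 ^ suc k * M ∎
    where
    open ≤-Reasoning
    double : ∀ p M → p * M + p * M ≡ (2 * p) * M
    double = solve-∀
    perToss : ∀ t → afterToss va vb vu k h t ≤ 2 ^ k * M
    perToss t with isPrefix rA (t ∷ h) | isPrefix rB (t ∷ h)
    ... | true | _ = *-monoʳ-≤ (2 ^ k) va≤M
    ... | false | true = *-monoʳ-≤ (2 ^ k) vb≤M
    ... | false | false = sumPayoff≤ M va vb vu va≤M vb≤M vu≤M k (t ∷ h)

  sumPayoff-open≤ : ∀ M vu → (∀ g → vu g ≤ M) → ∀ k h → sumPayoff 0 0 vu k h ≤ M * #open k h
  sumPayoff-open≤ M vu vu≤M zero h = ≤-trans (vu≤M h) (≤-reflexive (sym (*-identityʳ M)))
  sumPayoff-open≤ M vu vu≤M (suc k) h = begin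
      afterToss 0 0 vu k h true + afterToss 0 0 vu k h false ≤⟨ +-mono-≤ (perToss true) (perToss false) ⟩
      M * u true + M * u false                                ≡⟨ sym (*-distribˡ-+ M (u true) (u false)) ⟩
      M * #open (suc k) h ∎
    where
    open ≤-Reasoning
    u : Bool → ℕ
    u = afterToss 0 0 (λ _ → 1) k h
    perToss : ∀ t → afterToss 0 0 vu k h t ≤ M * u t
    perToss t with isPrefix rA (t ∷ h) | isPrefix rB (t ∷ h)
    ... | true | _ rewrite *-zeroʳ (2 ^ k) = z≤n
    ... | false | true rewrite *-zeroʳ (2 ^ k) = z≤n
    ... | false | false = sumPayoff-open≤ M vu vu≤M k (t ∷ h)

  #open≤ : ∀ k h → #open k h ≤ 2 ^ k
  #open≤ k h = ≤-trans (m≤n+m (#open k h) (#A k h + #B k h)) (≤-reflexive (#A+#B+#open k h))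

  -- A continuation still open after k tosses has lasted all k of them.
  k*#open≤duration : ∀ k h → k * #open k h ≤ duration k h
  k*#open≤duration zero h = z≤n
  k*#open≤duration (suc k) h = begin
      suc k * (u true + u false)                          ≡⟨ expand k (u true) (u false) ⟩
      (u true + u false) + (k * u true + k * u false)     ≤⟨ +-mono-≤ (#open≤ (suc k) h) (+-mono-≤ (perToss true) (perToss false)) ⟩
      2 ^ suc k + (durationAfter k h true + durationAfter k h false) ≡⟨ sym (+-assoc (2 ^ suc k) _ _) ⟩
      duration (suc k) h ∎
    where
    open ≤-Reasoning
    u : Bool → ℕ
    u = afterToss 0 0 (λ _ → 1) k h
    expand : ∀ k a b → suc k * (a + b) ≡ (a + b) + (k * a + k * b)
    expand = solve-∀
    perToss : ∀ t → k * u t ≤ durationAfter k h t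
    perToss t with isPrefix rA (t ∷ h) | isPrefix rB (t ∷ h)
    ... | true | _ rewrite *-zeroʳ (2 ^ k) | *-zeroʳ k = z≤n
    ... | false | true rewrite *-zeroʳ (2 ^ k) | *-zeroʳ k = z≤n
    ... | false | false = k*#open≤duration k (t ∷ h)

  countTrue-scan≡#B : ∀ k h → countTrue (map (scan rA rB h) (allSeqs k)) ≡ #B k h
  countTrue-scan≡#B zero h = refl
  countTrue-scan≡#B (suc k) h = begin
      countTrue (map (scan rA rB h) (map (true ∷_) S ++ map (false ∷_) S))
        ≡⟨ cong countTrue (List.map-++ (scan rA rB h) (map (true ∷_) S) (map (false ∷_) S)) ⟩
      countTrue (map (scan rA rB h) (map (true ∷_) S) ++ map (scan rA rB h) (map (false ∷_) S))
        ≡⟨ countTrue-++ (map (scan rA rB h) (map (true ∷_) S)) _ ⟩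
      countTrue (map (scan rA rB h) (map (true ∷_) S)) + countTrue (map (scan rA rB h) (map (false ∷_) S))
        ≡⟨ cong₂ _+_ (perToss true) (perToss false) ⟩
      #B (suc k) h ∎
    where
    open ≡-Reasoning
    S = allSeqs k
    perToss : ∀ t → countTrue (map (scan rA rB h) (map (t ∷_) S)) ≡ afterToss 0 1 (λ _ → 0) k h t
    perToss t = begin
        countTrue (map (scan rA rB h) (map (t ∷_) S))  ≡⟨ cong countTrue (sym (List.map-∘ S)) ⟩
        countTrue (map (λ s → scan rA rB h (t ∷ s)) S)
          ≡⟨ countTrue-if (isPrefix rA (t ∷ h)) (isPrefix rB (t ∷ h)) (scan rA rB (t ∷ h)) S ⟩
        outcome (isPrefix rA (t ∷ h)) (isPrefix rB (t ∷ h)) (length S * 0) (length S * 1)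
                (countTrue (map (scan rA rB (t ∷ h)) S))
          ≡⟨ cong₂ (λ l c → outcome (isPrefix rA (t ∷ h)) (isPrefix rB (t ∷ h)) (l * 0) (l * 1) c)
                   (length-allSeqs k) (countTrue-scan≡#B k (t ∷ h)) ⟩
        afterToss 0 1 (λ _ → 0) k h t ∎

-- halfPow k is mkℚᵘ (+ 1) (predPow2 k) in ℚᵘ, whose denominator field stores 2 ^ k − 1.
predPow2 : ℕ → ℕ
predPow2 zero = 0
predPow2 (suc k) = suc (2 * predPow2 k)

suc-predPow2 : ∀ k → suc (predPow2 k) ≡ 2 ^ k
suc-predPow2 zero = refl
suc-predPow2 (suc k) = begin
    suc (suc (2 * predPow2 k)) ≡⟨ cong suc (sym (+-suc (predPow2 k) (predPow2 k + 0))) ⟩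
    2 * suc (predPow2 k)       ≡⟨ cong (2 *_) (suc-predPow2 k) ⟩
    2 ^ suc k ∎
  where open ≡-Reasoning

halfPow≃ : ∀ k → toℚᵘ (halfPow k) ≃ mkℚᵘ (+ 1) (predPow2 k)
halfPow≃ zero = ℚᵘ.≃-refl
halfPow≃ (suc k) = ℚᵘ.≃-trans (ℚ.toℚᵘ-homo-* ½ (halfPow k))
  (ℚᵘ.≃-trans (ℚᵘ.*-cong (ℚ.toℚᵘ-fromℚᵘ (mkℚᵘ (+ 1) 1)) (halfPow≃ k))
              (ℚᵘ.*≡* cross))
  where
  cross : (+ 1 ℤ.* + 1) ℤ.* + suc (suc (2 * predPow2 k)) ≡ + 1 ℤ.* + (2 * suc (predPow2 k))
  cross = begin
      (+ 1 ℤ.* + 1) ℤ.* + suc (suc (2 * predPow2 k)) ≡⟨ ℤ.*-identityˡ _ ⟩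
      + suc (suc (2 * predPow2 k))                   ≡⟨ cong (+_ ∘ suc) (sym (+-suc (predPow2 k) (predPow2 k + 0))) ⟩
      + (2 * suc (predPow2 k))                       ≡⟨ sym (ℤ.*-identityˡ _) ⟩
      + 1 ℤ.* + (2 * suc (predPow2 k)) ∎
    where open ≡-Reasoning

count*halfPow≃ : ∀ c k → toℚᵘ ((+ c ℚ./ 1) ℚ.* halfPow k) ≃ mkℚᵘ (+ c) (predPow2 k)
count*halfPow≃ c k = ℚᵘ.≃-trans (ℚ.toℚᵘ-homo-* (+ c ℚ./ 1) (halfPow k))
  (ℚᵘ.≃-trans (ℚᵘ.*-cong (ℚ.toℚᵘ-fromℚᵘ (mkℚᵘ (+ c) 0)) (halfPow≃ k))
              (ℚᵘ.*≡* (cong₂ ℤ._*_ (ℤ.*-identityʳ (+ c)) (cong +_ (sym (*-identityˡ _))))))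

∣m⊖n∣≤ : ∀ {m n X} → m ≤ n + X → n ≤ m + X → ℤ.∣ m ⊖ n ∣ ≤ X
∣m⊖n∣≤ {m} {n} m≤n+X n≤m+X with ≤-total m n
... | inj₁ m≤n rewrite ℤ.∣⊖∣-≤ m≤n = m≤n+o⇒m∸n≤o n m n≤m+X
... | inj₂ n≤m rewrite ℤ.∣m⊖n∣≡∣n⊖m∣ m n | ℤ.∣⊖∣-≤ n≤m = m≤n+o⇒m∸n≤o m n m≤n+X

fraction-distance≤ : ∀ N a p Dm Sm Qm →
  ℤ.∣ N * suc Sm ⊖ a * suc Dm ∣ * suc Qm ≤ p * (suc Dm * suc Sm) →
  ℚᵘ.∣ mkℚᵘ (+ N) Dm ℚᵘ.- mkℚᵘ (+ a) Sm ∣ ℚᵘ.≤ mkℚᵘ (+ p) Qm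
fraction-distance≤ N a p Dm Sm Qm bound = *≤* goal
  where
  numerator : + N ℤ.* + suc Sm ℤ.+ (ℤ.- (+ a)) ℤ.* + suc Dm ≡ N * suc Sm ⊖ a * suc Dm
  numerator = begin
      + N ℤ.* + suc Sm ℤ.+ (ℤ.- (+ a)) ℤ.* + suc Dm
        ≡⟨ cong₂ ℤ._+_ (sym (ℤ.pos-* N (suc Sm))) (sym (ℤ.neg-distribˡ-* (+ a) (+ suc Dm))) ⟩
      + (N * suc Sm) ℤ.+ ℤ.- (+ a ℤ.* + suc Dm)
        ≡⟨ cong (λ z → + (N * suc Sm) ℤ.+ ℤ.- z) (sym (ℤ.pos-* a (suc Dm))) ⟩
      + (N * suc Sm) ℤ.+ ℤ.- (+ (a * suc Dm))
        ≡⟨ ℤ.m-n≡m⊖n (N * suc Sm) (a * suc Dm) ⟩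
      N * suc Sm ⊖ a * suc Dm ∎
    where open ≡-Reasoning
  goal : + ℤ.∣ + N ℤ.* + suc Sm ℤ.+ (ℤ.- (+ a)) ℤ.* + suc Dm ∣ ℤ.* + suc Qm ℤ.≤ + p ℤ.* + (suc Dm * suc Sm)
  goal rewrite numerator
             | sym (ℤ.pos-* ℤ.∣ N * suc Sm ⊖ a * suc Dm ∣ (suc Qm))
             | sym (ℤ.pos-* p (suc Dm * suc Sm)) = ℤ.+≤+ bound

∣c/2^k-a/s∣≤ : ∀ c k a Sm p Qm .{cp : Coprime p (suc Qm)} →
  ℤ.∣ c * suc Sm ⊖ a * 2 ^ k ∣ * suc Qm ≤ p * (2 ^ k * suc Sm) →
  ℚ.∣ (+ c ℚ./ 1) ℚ.* halfPow k ℚ.- + a ℚ./ suc Sm ∣ ℚ.≤ mkℚ (+ p) Qm cp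
∣c/2^k-a/s∣≤ c k a Sm p Qm bound = ℚ.toℚᵘ-cancel-≤ (ℚᵘ.≤-respˡ-≃ (ℚᵘ.≃-sym x-y≃)
  (fraction-distance≤ c a p (predPow2 k) Sm Qm
    (subst (λ D → ℤ.∣ c * suc Sm ⊖ a * D ∣ * suc Qm ≤ p * (D * suc Sm)) (sym (suc-predPow2 k)) bound)))
  where
  x = (+ c ℚ./ 1) ℚ.* halfPow k
  y = + a ℚ./ suc Sm
  x-y≃ : toℚᵘ ℚ.∣ x ℚ.- y ∣ ≃ ℚᵘ.∣ mkℚᵘ (+ c) (predPow2 k) ℚᵘ.- mkℚᵘ (+ a) Sm ∣
  x-y≃ = ℚᵘ.≃-trans (ℚ.toℚᵘ-homo-∣-∣ (x ℚ.- y))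
          (ℚᵘ.∣-∣-cong (ℚᵘ.≃-trans (ℚ.toℚᵘ-homo-+ x (ℚ.- y))
            (ℚᵘ.+-cong (count*halfPow≃ c k)
                       (ℚᵘ.≃-trans (ℚ.toℚᵘ-homo‿- y) (ℚᵘ.-‿cong (ℚ.toℚᵘ-fromℚᵘ (mkℚᵘ (+ a) Sm)))))))

positive⇒numerator≥1 : ∀ {p Qm} .{cp : Coprime p (suc Qm)} → 0ℚ ℚ.< mkℚ (+ p) Qm cp → 1 ≤ p
positive⇒numerator≥1 {zero} (ℚ.*<* (ℤ.+<+ ()))
positive⇒numerator≥1 {suc p} _ = s≤s z≤n

Tendsto : (ℕ → ℚ) → ℚ → Set
Tendsto f q = ∀ ε → 0ℚ ℚ.< ε → ∃[ K ] (∀ k → K ≤ k → ℚ.∣ f k ℚ.- q ∣ ℚ.≤ ε)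

tendsto-unique : ∀ {f q q′} → Tendsto f q → Tendsto f q′ → q ≡ q′
tendsto-unique {f} {q} {q′} f→q f→q′ = x∙y⁻¹≈ε⇒x≈y q q′ (ℚ.∣p∣≡0⇒p≡0 (q ℚ.- q′) d≡0)
  where
  open import Algebra.Properties.Group ℚ.+-0-group using (x∙y⁻¹≈ε⇒x≈y)
  d = ℚ.∣ q ℚ.- q′ ∣
  d≤2ε : ∀ ε → 0ℚ ℚ.< ε → d ℚ.≤ ε ℚ.+ ε
  d≤2ε ε ε>0 with f→q ε ε>0 | f→q′ ε ε>0
  ... | K , close | K′ , close′ =
    ℚ.≤-trans (subst (λ z → ℚ.∣ z ∣ ℚ.≤ ℚ.∣ x ℚ.- q′ ∣ ℚ.+ ℚ.∣ x ℚ.- q ∣) (difference x q q′)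
                     (ℚ.∣p-q∣≤∣p∣+∣q∣ (x ℚ.- q′) (x ℚ.- q)))
              (ℚ.+-mono-≤ (close′ k (m≤n⊔m K K′)) (close k (m≤m⊔n K K′)))
    where
    k = K ⊔ K′
    x = f k
    difference : ∀ x q q′ → (x ℚ.- q′) ℚ.- (x ℚ.- q) ≡ q ℚ.- q′
    difference = solve 3 (λ x q q′ → (x :- q′) :- (x :- q) := q :- q′) refl
      where open +-*-Solver
  d≯0 : ¬ (0ℚ ℚ.< d)
  d≯0 d>0 = ℚ.<-irrefl refl (ℚ.<-≤-trans 2ε<d (d≤2ε ε ε>0))
    where
    instance
      d-positive : ℚ.Positive d
      d-positive = ℚ.positive d>0
    ¼ : ℚ
    ¼ = + 1 ℚ./ 4
    ε = ¼ ℚ.* d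
    ε>0 : 0ℚ ℚ.< ε
    ε>0 = ℚ.positive⁻¹ ε {{ℚ.pos*pos⇒pos ¼ d}}
    ½<1 : ½ ℚ.< 1ℚ
    ½<1 = toWitness {a? = ½ ℚ.<? 1ℚ} _
    2ε<d : ε ℚ.+ ε ℚ.< d
    2ε<d = subst (ℚ._< d) (ℚ.*-distribʳ-+ d ¼ ¼) (subst (½ ℚ.* d ℚ.<_) (ℚ.*-identityˡ d) (ℚ.*-monoˡ-<-pos d ½<1))
  d≡0 : d ≡ 0ℚ
  d≡0 = ℚ.≤-antisym (ℚ.≮⇒≥ d≯0) (ℚ.0≤∣p∣ (q ℚ.- q′))

-- Conway's formula

conway-arith : ∀ {αA βB} αB βA a b nA nB u RA RB D → βA + a ≡ αA → αB + b ≡ βB →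
  αA * nA + αB * nB + RA ≡ βA * nA + βB * nB + RB → nA + nB + u ≡ D →
  nB * (a + b) + RB + a * u ≡ a * D + RA
conway-arith αB βA a b nA nB u RA RB D refl refl stopped total = begin
    nB * (a + b) + RB + a * u      ≡⟨ expand-B nB a b RB u ⟩
    (b * nB + RB) + a * nB + a * u ≡⟨ cong (λ z → z + a * nB + a * u) (sym A-side≡B-side) ⟩
    (a * nA + RA) + a * nB + a * u ≡⟨ collect-A a nA nB u RA ⟩
    a * (nA + nB + u) + RA         ≡⟨ cong (λ z → a * z + RA) total ⟩
    a * D + RA ∎
  where
  open ≡-Reasoning
  A-side≡B-side : a * nA + RA ≡ b * nB + RB
  A-side≡B-side = +-cancelˡ-≡ (βA * nA + αB * nB) _ _ (begin
      βA * nA + αB * nB + (a * nA + RA) ≡⟨ split-A βA αB a nA nB RA ⟩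
      (βA + a) * nA + αB * nB + RA      ≡⟨ stopped ⟩
      βA * nA + (αB + b) * nB + RB      ≡⟨ split-B βA αB b nA nB RB ⟩
      βA * nA + αB * nB + (b * nB + RB) ∎)
    where
    split-A : ∀ βA αB a nA nB RA → βA * nA + αB * nB + (a * nA + RA) ≡ (βA + a) * nA + αB * nB + RA
    split-A = solve-∀
    split-B : ∀ βA αB b nA nB RB → βA * nA + (αB + b) * nB + RB ≡ βA * nA + αB * nB + (b * nB + RB)
    split-B = solve-∀
  expand-B : ∀ nB a b RB u → nB * (a + b) + RB + a * u ≡ (b * nB + RB) + a * nB + a * u
  expand-B = solve-∀
  collect-A : ∀ a nA nB u RA → (a * nA + RA) + a * nB + a * u ≡ a * (nA + nB + u) + RA
  collect-A = solve-∀

identity⇒∣⊖∣≤ : ∀ N s a D u RA RB M → N * s + RB + a * u ≡ a * D + RA →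
  RA ≤ M * u → RB ≤ M * u → a ≤ M → ℤ.∣ N * s ⊖ a * D ∣ ≤ 2 * (M * u)
identity⇒∣⊖∣≤ N s a D u RA RB M identity RA≤Mu RB≤Mu a≤M = ∣m⊖n∣≤ upper lower
  where
  open ≤-Reasoning
  twice : ∀ x y → x + y + y ≡ x + 2 * y
  twice = solve-∀
  upper : N * s ≤ a * D + 2 * (M * u)
  upper = begin
      N * s                ≤⟨ m≤m+n (N * s) (RB + a * u) ⟩
      N * s + (RB + a * u) ≡⟨ sym (+-assoc (N * s) RB (a * u)) ⟩
      N * s + RB + a * u   ≡⟨ identity ⟩
      a * D + RA           ≤⟨ +-monoʳ-≤ (a * D) (≤-trans RA≤Mu (m≤m+n (M * u) (M * u + 0))) ⟩
      a * D + 2 * (M * u)  ∎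
  lower : a * D ≤ N * s + 2 * (M * u)
  lower = begin
      a * D                 ≤⟨ m≤m+n (a * D) RA ⟩
      a * D + RA            ≡⟨ sym identity ⟩
      N * s + RB + a * u    ≤⟨ +-mono-≤ (+-monoʳ-≤ (N * s) RB≤Mu) (*-monoˡ-≤ u a≤M) ⟩
      N * s + M * u + M * u ≡⟨ twice (N * s) (M * u) ⟩
      N * s + 2 * (M * u)   ∎

module ConwayLimit (rA rB : List Bool) {n} (|rA| : length rA ≡ suc n) (|rB| : length rB ≡ suc n)
                  {a b s} (BA+a≡AA : wealth rB rA + a ≡ wealth rA rA) (AB+b≡BB : wealth rA rB + b ≡ wealth rB rB)
                  (a+b≡1+s : a + b ≡ suc s) where

  open FirstToAppear rA rB

  M : ℕ
  M = 2 ^ suc (suc n)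

  wealth≤M : ∀ rX → length rX ≡ suc n → ∀ g → wealth rX g ≤ M
  wealth≤M rX |rX| g = subst (wealth rX g ≤_) (cong (λ l → 2 ^ suc l) |rX|) (wealth≤ rX g)

  a≤M : a ≤ M
  a≤M = ≤-trans (m≤n+m a (wealth rB rA)) (≤-trans (≤-reflexive BA+a≡AA) (wealth≤M rA |rA| rA))

  stopped-payoff≡duration : ∀ rX → (rX ≡ rA ⊎ rX ≡ rB) → length rX ≡ suc n → ∀ k →
    sumPayoff (wealth rX rA) (wealth rX rB) (wealth rX) k [] ≡ duration k []
  stopped-payoff≡duration rX rX∈ |rX| k = begin
      sumPayoff (wealth rX rA) (wealth rX rB) (wealth rX) k []
        ≡⟨ optional-stopping rX rX∈ (≤-reflexive (trans |rX| (sym |rA|))) (≤-reflexive (trans |rX| (sym |rB|))) k []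
             (nonempty∉[] rA |rA|) (nonempty∉[] rB |rB|) ⟩
      2 ^ k * wealth rX [] + duration k [] ≡⟨ cong (λ w → 2 ^ k * w + duration k []) (wealth-[] rX) ⟩
      2 ^ k * 0 + duration k []            ≡⟨ cong (_+ duration k []) (*-zeroʳ (2 ^ k)) ⟩
      duration k [] ∎
    where
    open ≡-Reasoning
    nonempty∉[] : ∀ r → length r ≡ suc n → isPrefix r [] ≡ false
    nonempty∉[] (_ ∷ _) _ = refl

  residual : List Bool → ℕ → ℕ
  residual rX k = sumPayoff 0 0 (wealth rX) k []

  conway-identity : ∀ k → #B k [] * (a + b) + residual rB k + a * #open k [] ≡ a * 2 ^ k + residual rA k
  conway-identity k =
    conway-arith (wealth rA rB) (wealth rB rA) a b (#A k []) (#B k []) (#open k []) (residual rA k) (residual rB k) (2 ^ k)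
    BA+a≡AA AB+b≡BB
    (begin
      wealth rA rA * #A k [] + wealth rA rB * #B k [] + residual rA k ≡⟨ sym (sumPayoff-linear _ _ (wealth rA) k []) ⟩
      sumPayoff (wealth rA rA) (wealth rA rB) (wealth rA) k []       ≡⟨ stopped-payoff≡duration rA (inj₁ refl) |rA| k ⟩
      duration k []                                                  ≡⟨ sym (stopped-payoff≡duration rB (inj₂ refl) |rB| k) ⟩
      sumPayoff (wealth rB rA) (wealth rB rB) (wealth rB) k []       ≡⟨ sumPayoff-linear _ _ (wealth rB) k [] ⟩
      wealth rB rA * #A k [] + wealth rB rB * #B k [] + residual rB k ∎)
    (#A+#B+#open k [])
    where open ≡-Reasoning

  #B-distance≤ : ∀ k → ℤ.∣ #B k [] * suc s ⊖ a * 2 ^ k ∣ ≤ 2 * (M * #open k [])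
  #B-distance≤ k = identity⇒∣⊖∣≤ (#B k []) (suc s) a (2 ^ k) (#open k []) (residual rA k) (residual rB k) M
    (subst (λ z → #B k [] * z + residual rB k + a * #open k [] ≡ a * 2 ^ k + residual rA k) a+b≡1+s (conway-identity k))
    (sumPayoff-open≤ M (wealth rA) (wealth≤M rA |rA|) k [])
    (sumPayoff-open≤ M (wealth rB) (wealth≤M rB |rB|) k [])
    a≤M

  -- The open continuations are a vanishing fraction: each has run for k tosses, while
  -- the total duration is the gamblers' final wealth, at most M per continuation.
  M*#open≤2^k : ∀ q k → 2 * M * M * q ≤ k → 2 * (M * #open k []) * q ≤ 2 ^ k
  M*#open≤2^k q k K≤k = *-cancelʳ-≤ _ _ M {{m^n≢0 2 (suc (suc n))}} (begin
      2 * (M * u) * q * M ≡⟨ reorder M u q ⟩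
      2 * M * M * q * u   ≤⟨ *-monoˡ-≤ u K≤k ⟩
      k * u               ≤⟨ k*#open≤duration k [] ⟩
      duration k []       ≡⟨ sym (stopped-payoff≡duration rA (inj₁ refl) |rA| k) ⟩
      sumPayoff (wealth rA rA) (wealth rA rB) (wealth rA) k []
                          ≤⟨ sumPayoff≤ M _ _ _ (wealth≤M rA |rA| rA) (wealth≤M rA |rA| rB) (wealth≤M rA |rA|) k [] ⟩
      2 ^ k * M ∎)
    where
    open ≤-Reasoning
    u = #open k []
    reorder : ∀ M u q → 2 * (M * u) * q * M ≡ 2 * M * M * q * u
    reorder = solve-∀

  conway-limit : Tendsto (λ k → (+ countTrue (map (scan rA rB []) (allSeqs k)) ℚ./ 1) ℚ.* halfPow k) (+ a ℚ./ suc s)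
  conway-limit (mkℚ -[1+ _ ] _ _) (ℚ.*<* ())
  conway-limit (mkℚ (+ p) Qm _) ε>0 = 2 * M * M * suc Qm , close
    where
    close : ∀ k → 2 * M * M * suc Qm ≤ k →
      ℚ.∣ (+ countTrue (map (scan rA rB []) (allSeqs k)) ℚ./ 1) ℚ.* halfPow k ℚ.- + a ℚ./ suc s ∣ ℚ.≤ _
    close k K≤k rewrite countTrue-scan≡#B k [] = ∣c/2^k-a/s∣≤ (#B k []) k a s p Qm (begin
        ℤ.∣ #B k [] * suc s ⊖ a * 2 ^ k ∣ * suc Qm
          ≤⟨ *-monoˡ-≤ (suc Qm) (#B-distance≤ k) ⟩
        2 * (M * #open k []) * suc Qm ≤⟨ M*#open≤2^k (suc Qm) k K≤k ⟩
        2 ^ k                         ≤⟨ m≤n*m (2 ^ k) (suc s) ⟩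
        suc s * 2 ^ k                 ≡⟨ *-comm (suc s) (2 ^ k) ⟩
        2 ^ k * suc s                 ≡⟨ sym (*-identityˡ _) ⟩
        1 * (2 ^ k * suc s)           ≤⟨ *-monoˡ-≤ _ (positive⇒numerator≥1 ε>0) ⟩
        p * (2 ^ k * suc s) ∎)
      where open ≤-Reasoning

-- Constant strings

isPrefix-∷-not : ∀ c s g → isPrefix (c ∷ s) (not c ∷ g) ≡ false
isPrefix-∷-not true s g = refl
isPrefix-∷-not false s g = refl

isPrefix-not-∷ : ∀ c s g → isPrefix (not c ∷ s) (c ∷ g) ≡ false
isPrefix-not-∷ true s g = refl
isPrefix-not-∷ false s g = refl

-- Termwise, [ s ≼ R ] + [ s ≼ c…c ] ≤ 1 + [ c…c ≼ R ], as s ≼ c…c forces s = c…c.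
wealth-tail≤replicate : ∀ t R n c → length t ≤ n →
  wealth t R + wealth t (replicate n c) ≤ wealth (replicate (length t) c) (replicate n c) + wealth (replicate (length t) c) R
wealth-tail≤replicate [] R n c _ = z≤n
wealth-tail≤replicate (x ∷ t) R n c |x∷t|≤n = begin
    ([ isPrefix (x ∷ t) R ]× X + wealth t R) + ([ isPrefix (x ∷ t) C ]× X + wealth t C)
      ≡⟨ swap ([ isPrefix (x ∷ t) R ]× X) (wealth t R) _ (wealth t C) ⟩
    ([ isPrefix (x ∷ t) R ]× X + [ isPrefix (x ∷ t) C ]× X) + (wealth t R + wealth t C)
      ≤⟨ +-mono-≤ (head-terms (isPrefix (x ∷ t) C) refl) (wealth-tail≤replicate t R n c (≤-trans (n≤1+n _) |x∷t|≤n)) ⟩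
    (X + [ isPrefix (c ∷ ct) R ]× X) + (wealth ct C + wealth ct R)
      ≡⟨ sym (swap X (wealth ct C) _ (wealth ct R)) ⟩
    (X + wealth ct C) + ([ isPrefix (c ∷ ct) R ]× X + wealth ct R)
      ≡⟨ cong (λ Z → (Z + wealth ct C) + ([ isPrefix (c ∷ ct) R ]× Z + wealth ct R)) (sym Y≡X) ⟩
    (Y + wealth ct C) + ([ isPrefix (c ∷ ct) R ]× Y + wealth ct R)
      ≡⟨ cong (_+ wealth (c ∷ ct) R) (sym (wealth-∷-matched c ct C (replicate-isPrefix c |x∷t|≤n))) ⟩
    wealth (c ∷ ct) C + wealth (c ∷ ct) R ∎
  where
  open ≤-Reasoning
  C = replicate n c
  ct = replicate (length t) c
  X = 2 ^ suc (length t)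
  Y = 2 ^ suc (length ct)
  Y≡X : Y ≡ X
  Y≡X = cong (λ l → 2 ^ suc l) (List.length-replicate (length t))
  swap : ∀ a b c d → (a + b) + (c + d) ≡ (a + c) + (b + d)
  swap = solve-∀
  head-terms : ∀ b → isPrefix (x ∷ t) C ≡ b → [ isPrefix (x ∷ t) R ]× X + [ b ]× X ≤ X + [ isPrefix (c ∷ ct) R ]× X
  head-terms true matched rewrite isPrefix-replicate⇒≡ (x ∷ t) n c matched = ≤-reflexive (+-comm _ X)
  head-terms false _ = ≤-trans (≤-reflexive (+-identityʳ _)) (≤-trans ([]×-≤ (isPrefix (x ∷ t) R) X) (m≤m+n X _))

wealth-self+cross≤replicate : ∀ R n c → length R ≡ n →
  wealth R R + wealth R (replicate n c) ≤ wealth (replicate n c) (replicate n c) + wealth (replicate n c) R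
wealth-self+cross≤replicate R n c |R| =
  subst (λ m → wealth R R + wealth R (replicate n c) ≤ wealth (replicate m c) (replicate n c) + wealth (replicate m c) R)
        |R| (wealth-tail≤replicate R R n c (≤-reflexive |R|))

wealth-tail<replicate : ∀ x t R n c → suc (length t) ≤ n →
  isPrefix (x ∷ t) R ≡ false → isPrefix (x ∷ t) (replicate n c) ≡ false →
  wealth (x ∷ t) R + wealth (x ∷ t) (replicate n c)
    < wealth (replicate (suc (length t)) c) (replicate n c) + wealth (replicate (suc (length t)) c) R
wealth-tail<replicate x t R n c |x∷t|≤n x∷t∉R x∷t∉C = begin-strict
    wealth (x ∷ t) R + wealth (x ∷ t) C
      ≡⟨ cong₂ _+_ (wealth-∷-unmatched x t R x∷t∉R) (wealth-∷-unmatched x t C x∷t∉C) ⟩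
    wealth t R + wealth t C           ≤⟨ wealth-tail≤replicate t R n c (≤-trans (n≤1+n _) |x∷t|≤n) ⟩
    wealth ct C + wealth ct R         <⟨ m<n+m _ (m^n>0 2 (suc (length ct))) ⟩
    Y + (wealth ct C + wealth ct R)   ≡⟨ sym (+-assoc Y (wealth ct C) (wealth ct R)) ⟩
    Y + wealth ct C + wealth ct R     ≤⟨ +-monoʳ-≤ (Y + wealth ct C) (m≤n+m (wealth ct R) ([ isPrefix (c ∷ ct) R ]× Y)) ⟩
    (Y + wealth ct C) + ([ isPrefix (c ∷ ct) R ]× Y + wealth ct R)
      ≡⟨ cong (_+ wealth (c ∷ ct) R) (sym (wealth-∷-matched c ct C (replicate-isPrefix c |x∷t|≤n))) ⟩
    wealth (c ∷ ct) C + wealth (c ∷ ct) R ∎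
  where
  open ≤-Reasoning
  C = replicate n c
  ct = replicate (length t) c
  Y = 2 ^ suc (length ct)

wealth-self+cross<replicate : ∀ c x t {n} → length t ≡ n → c ∷ x ∷ t ≢ replicate (suc (suc n)) c →
  wealth (c ∷ x ∷ t) (c ∷ x ∷ t) + wealth (c ∷ x ∷ t) (replicate (suc (suc n)) c)
    < wealth (replicate (suc (suc n)) c) (replicate (suc (suc n)) c) + wealth (replicate (suc (suc n)) c) (c ∷ x ∷ t)
wealth-self+cross<replicate c x t refl R≢C = begin-strict
    wealth R R + wealth R C
      ≡⟨ cong₂ _+_ (wealth-∷-matched c s R (isPrefix-refl R)) (wealth-∷-unmatched c s C R∉C) ⟩
    (X + wealth s R) + wealth s C           ≡⟨ +-assoc X (wealth s R) (wealth s C) ⟩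
    X + (wealth s R + wealth s C)           <⟨ +-monoʳ-< X (wealth-tail<replicate x t R (suc (suc (length t))) c (n≤1+n _) s∉R s∉C) ⟩
    X + (wealth Cs C + wealth Cs R)         ≡⟨ cong (_+ (wealth Cs C + wealth Cs R)) X≡X′ ⟩
    X′ + (wealth Cs C + wealth Cs R)        ≡⟨ sym (+-assoc X′ (wealth Cs C) (wealth Cs R)) ⟩
    (X′ + wealth Cs C) + wealth Cs R
      ≡⟨ sym (cong₂ _+_ (wealth-∷-matched c Cs C (isPrefix-refl C)) (wealth-∷-unmatched c Cs R C∉R)) ⟩
    wealth C C + wealth C R ∎
  where
  open ≤-Reasoning
  s = x ∷ t
  R = c ∷ s
  Cs = replicate (suc (length t)) c
  C = c ∷ Cs
  X = 2 ^ suc (length s)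
  X′ = 2 ^ suc (length Cs)
  X≡X′ : X ≡ X′
  X≡X′ = cong (λ l → 2 ^ suc l) (sym (List.length-replicate (suc (length t))))
  |R|≡|C| : length R ≡ length C
  |R|≡|C| = cong (suc ∘ suc) (sym (List.length-replicate (length t)))
  R∉C : isPrefix R C ≡ false
  R∉C = Bool.¬-not (λ R≼C → R≢C (isPrefix⇒≡ R C R≼C |R|≡|C|))
  C∉R : isPrefix C R ≡ false
  C∉R = Bool.¬-not (λ C≼R → R≢C (sym (isPrefix⇒≡ C R C≼R (sym |R|≡|C|))))
  s∉R : isPrefix s R ≡ false
  s∉R = Bool.¬-not (λ s≼R → R≢C (cong (c ∷_) (isPrefix-∷⇒≡replicate s c s≼R)))
  s∉C : isPrefix s C ≡ false
  s∉C = Bool.¬-not (λ s≼C → R≢C (cong (c ∷_) (isPrefix-replicate⇒≡ s (suc (suc (length t))) c s≼C)))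

wealth-self+cross-replicate≡ : ∀ c m →
  wealth (replicate (suc m) c) (replicate (suc m) c) + wealth (replicate (suc m) c) (not c ∷ replicate m c)
    ≡ wealth (not c ∷ replicate m c) (not c ∷ replicate m c) + wealth (not c ∷ replicate m c) (replicate (suc m) c)
wealth-self+cross-replicate≡ c m = begin
    wealth C C + wealth C B
      ≡⟨ cong₂ _+_ (wealth-∷-matched c Cm C (isPrefix-refl C)) (wealth-∷-unmatched c Cm B (isPrefix-∷-not c Cm Cm)) ⟩
    (X + wealth Cm C) + wealth Cm B  ≡⟨ swap X (wealth Cm C) (wealth Cm B) ⟩
    (X + wealth Cm B) + wealth Cm C
      ≡⟨ sym (cong₂ _+_ (wealth-∷-matched (not c) Cm B (isPrefix-refl B)) (wealth-∷-unmatched (not c) Cm C (isPrefix-not-∷ c Cm Cm))) ⟩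
    wealth B B + wealth B C ∎
  where
  open ≡-Reasoning
  Cm = replicate m c
  C = c ∷ Cm
  B = not c ∷ Cm
  X = 2 ^ suc (length Cm)
  swap : ∀ x a b → (x + a) + b ≡ (x + b) + a
  swap = solve-∀

rev : ∀ {n} → Vec Bool n → List Bool
rev A = List.reverse (toList A)

length-rev : ∀ {n} (A : Vec Bool n) → length (rev A) ≡ n
length-rev A = trans (List.length-reverse (toList A)) (Vec.length-toList A)

rev-injective : ∀ {n} {A B : Vec Bool n} → rev A ≡ rev B → A ≡ B
rev-injective {A = A} {B} eq = trans (sym (Vec.cast-is-id refl A)) (Vec.toList-injective refl A B (List.reverse-injective eq))

reverse-replicate : ∀ n (c : Bool) → List.reverse (replicate n c) ≡ replicate n c
reverse-replicate zero c = refl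
reverse-replicate (suc n) c = begin
    List.reverse (c ∷ replicate n c)      ≡⟨ List.unfold-reverse c (replicate n c) ⟩
    List.reverse (replicate n c) List.∷ʳ c ≡⟨ cong (List._∷ʳ c) (reverse-replicate n c) ⟩
    replicate n c List.∷ʳ c               ≡⟨ replicate-∷ʳ n ⟩
    c ∷ replicate n c ∎
  where
  open ≡-Reasoning
  replicate-∷ʳ : ∀ n → replicate n c List.∷ʳ c ≡ c ∷ replicate n c
  replicate-∷ʳ zero = refl
  replicate-∷ʳ (suc n) = cong (c ∷_) (replicate-∷ʳ n)

rev-replicate : ∀ n (c : Bool) → rev (Vec.replicate n c) ≡ replicate n c
rev-replicate n c = trans (cong List.reverse (Vec.toList-replicate n c)) (reverse-replicate n c)

flippedLast : Bool → ∀ m → Vec Bool (suc m)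
flippedLast c m = Vec.reverse (not c Vec.∷ Vec.replicate m c)

rev-flippedLast : ∀ c m → rev (flippedLast c m) ≡ not c ∷ replicate m c
rev-flippedLast c m = begin
    List.reverse (toList (Vec.reverse (not c Vec.∷ Vec.replicate m c)))
      ≡⟨ cong List.reverse (Vec.toList-reverse (not c Vec.∷ Vec.replicate m c)) ⟩
    List.reverse (List.reverse (not c ∷ toList (Vec.replicate m c)))
      ≡⟨ List.reverse-involutive (not c ∷ toList (Vec.replicate m c)) ⟩
    not c ∷ toList (Vec.replicate m c)
      ≡⟨ cong (not c ∷_) (Vec.toList-replicate m c) ⟩
    not c ∷ replicate m c ∎
  where open ≡-Reasoning

-- Conway's formula P(B before A) = a / (a + b), with the two differences of
-- correlations a = AA − BA and b = BB − AB (both positive, as B ≠ A).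
record Odds {n} (A B : Vec Bool n) : Set where
  field
    a b s : ℕ
    a+b≡1+s : a + b ≡ suc s
    BA+a≡AA : wealth (rev B) (rev A) + a ≡ wealth (rev A) (rev A)
    AB+b≡BB : wealth (rev A) (rev B) + b ≡ wealth (rev B) (rev B)
    limit : ProbBBeforeA A B (+ a ℚ./ suc s)

odds : ∀ {m} (A B : Vec Bool (suc m)) → B ≢ A → Odds A B
odds A B B≢A = record
  { a = a ; b = b ; s = a + b ∸ 1 ; a+b≡1+s = a+b≡1+s ; BA+a≡AA = BA+a≡AA ; AB+b≡BB = AB+b≡BB
  ; limit = ConwayLimit.conway-limit (rev A) (rev B) (length-rev A) (length-rev B) BA+a≡AA AB+b≡BB a+b≡1+s }
  where
  BA<AA : wealth (rev B) (rev A) < wealth (rev A) (rev A)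
  BA<AA = wealth-cross<wealth-self (rev A) (rev B) (trans (length-rev B) (sym (length-rev A))) (B≢A ∘ rev-injective)
  AB<BB : wealth (rev A) (rev B) < wealth (rev B) (rev B)
  AB<BB = wealth-cross<wealth-self (rev B) (rev A) (trans (length-rev A) (sym (length-rev B))) (B≢A ∘ sym ∘ rev-injective)
  a b : ℕ
  a = wealth (rev A) (rev A) ∸ wealth (rev B) (rev A)
  b = wealth (rev B) (rev B) ∸ wealth (rev A) (rev B)
  BA+a≡AA : wealth (rev B) (rev A) + a ≡ wealth (rev A) (rev A)
  BA+a≡AA = m+[n∸m]≡n (<⇒≤ BA<AA)
  AB+b≡BB : wealth (rev A) (rev B) + b ≡ wealth (rev B) (rev B)
  AB+b≡BB = m+[n∸m]≡n (<⇒≤ AB<BB)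
  a+b≡1+s : a + b ≡ suc (a + b ∸ 1)
  a+b≡1+s = sym (suc-pred (a + b) {{ℕ.>-nonZero (<-≤-trans (m<n⇒0<n∸m BA<AA) (m≤m+n a b))}})

conway-odds≤ : ∀ {AA AB BA BB a b} → BA + a ≡ AA → AB + b ≡ BB → AA + AB ≤ BB + BA → a ≤ b
conway-odds≤ {AB = AB} {BA} {a = a} {b} refl refl AA+AB≤BB+BA =
  +-cancelˡ-≤ (BA + AB) a b (subst₂ _≤_ (regroup BA AB a) (regroup′ BA AB b) AA+AB≤BB+BA)
  where
  regroup : ∀ x y z → (x + z) + y ≡ (x + y) + z
  regroup = solve-∀
  regroup′ : ∀ x y z → (y + z) + x ≡ (x + y) + z
  regroup′ = solve-∀

conway-odds< : ∀ {AA AB BA BB a b} → BA + a ≡ AA → AB + b ≡ BB → AA + AB < BB + BA → a < b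
conway-odds< BA+a≡AA AB+b≡BB = conway-odds≤ (trans (+-suc _ _) (cong suc BA+a≡AA)) AB+b≡BB

toℚᵘ-½ : toℚᵘ ½ ℚᵘ.≃ mkℚᵘ (+ 1) 1
toℚᵘ-½ = ℚ.toℚᵘ-fromℚᵘ (mkℚᵘ (+ 1) 1)

toℚᵘ-a/1+s : ∀ a s → toℚᵘ (+ a ℚ./ suc s) ℚᵘ.≃ mkℚᵘ (+ a) s
toℚᵘ-a/1+s a s = ℚ.toℚᵘ-fromℚᵘ (mkℚᵘ (+ a) s)

a+a≡a*2 : ∀ a → a + a ≡ a * 2
a+a≡a*2 = solve-∀

½≤a/1+s : ∀ {a b s} → a + b ≡ suc s → b ≤ a → ½ ℚ.≤ + a ℚ./ suc s
½≤a/1+s {a} {b} {s} a+b≡1+s b≤a =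
  ℚ.toℚᵘ-cancel-≤ (ℚᵘ.≤-respˡ-≃ (ℚᵘ.≃-sym toℚᵘ-½) (ℚᵘ.≤-respʳ-≃ (ℚᵘ.≃-sym (toℚᵘ-a/1+s a s)) (*≤* cross)))
  where
  open ≤-Reasoning
  cross : + 1 ℤ.* + suc s ℤ.≤ + a ℤ.* + 2
  cross = subst₂ ℤ._≤_ (sym (ℤ.*-identityˡ _)) (ℤ.pos-* a 2) (ℤ.+≤+ (begin
    suc s ≡⟨ sym a+b≡1+s ⟩ a + b ≤⟨ +-monoʳ-≤ a b≤a ⟩ a + a ≡⟨ a+a≡a*2 a ⟩ a * 2 ∎))

a/1+s≤½ : ∀ {a b s} → a + b ≡ suc s → a ≤ b → + a ℚ./ suc s ℚ.≤ ½
a/1+s≤½ {a} {b} {s} a+b≡1+s a≤b =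
  ℚ.toℚᵘ-cancel-≤ (ℚᵘ.≤-respʳ-≃ (ℚᵘ.≃-sym toℚᵘ-½) (ℚᵘ.≤-respˡ-≃ (ℚᵘ.≃-sym (toℚᵘ-a/1+s a s)) (*≤* cross)))
  where
  open ≤-Reasoning
  cross : + a ℤ.* + 2 ℤ.≤ + 1 ℤ.* + suc s
  cross = subst₂ ℤ._≤_ (ℤ.pos-* a 2) (sym (ℤ.*-identityˡ _)) (ℤ.+≤+ (begin
    a * 2 ≡⟨ sym (a+a≡a*2 a) ⟩ a + a ≤⟨ +-monoʳ-≤ a a≤b ⟩ a + b ≡⟨ a+b≡1+s ⟩ suc s ∎))

a/1+s<½ : ∀ {a b s} → a + b ≡ suc s → a < b → + a ℚ./ suc s ℚ.< ½
a/1+s<½ {a} {b} {s} a+b≡1+s a<b =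
  ℚ.toℚᵘ-cancel-< (ℚᵘ.<-respʳ-≃ (ℚᵘ.≃-sym toℚᵘ-½) (ℚᵘ.<-respˡ-≃ (ℚᵘ.≃-sym (toℚᵘ-a/1+s a s)) (*<* cross)))
  where
  open ≤-Reasoning
  cross : + a ℤ.* + 2 ℤ.< + 1 ℤ.* + suc s
  cross = subst₂ ℤ._<_ (ℤ.pos-* a 2) (sym (ℤ.*-identityˡ _)) (ℤ.+<+ (begin-strict
    a * 2 ≡⟨ sym (a+a≡a*2 a) ⟩ a + a <⟨ +-monoʳ-< a a<b ⟩ a + b ≡⟨ a+b≡1+s ⟩ suc s ∎))

Value-≤ : ∀ {n} {A : Vec Bool n} {v w} → Value A v → Value A w → v ℚ.≤ w
Value-≤ (v≤ , _) (_ , B , B≢A , B→w) = v≤ B B≢A _ B→w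

replicate-value : ∀ m c → Value (Vec.replicate (suc m) c) ½
replicate-value m c = ½≤ , F , F≢A , ½-attained
  where
  A = Vec.replicate (suc m) c
  F = flippedLast c m
  revA : rev A ≡ replicate (suc m) c
  revA = rev-replicate (suc m) c
  ½≤ : ∀ B → B ≢ A → ∀ q → ProbBBeforeA A B q → ½ ℚ.≤ q
  ½≤ B B≢A q B→q = subst (½ ℚ.≤_) (tendsto-unique {f = probWithin A B} limit B→q) (½≤a/1+s a+b≡1+s (conway-odds≤ AB+b≡BB BA+a≡AA A-dominates))
    where
    open Odds (odds A B B≢A)
    A-dominates : wealth (rev B) (rev B) + wealth (rev B) (rev A) ≤ wealth (rev A) (rev A) + wealth (rev A) (rev B)
    A-dominates = subst (λ C → wealth (rev B) (rev B) + wealth (rev B) C ≤ wealth C C + wealth C (rev B))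
                        (sym revA) (wealth-self+cross≤replicate (rev B) (suc m) c (length-rev B))
  F≢A : F ≢ A
  F≢A F≡A = Bool.not-¬ refl (sym (List.∷-injectiveˡ (trans (sym (rev-flippedLast c m)) (trans (cong rev F≡A) revA))))
  ½-attained : ProbBBeforeA A F ½
  ½-attained = subst (ProbBBeforeA A F) (ℚ.≤-antisym (a/1+s≤½ a+b≡1+s a≤b) (½≤a/1+s a+b≡1+s b≤a)) limit
    where
    open Odds (odds A F F≢A)
    balanced : wealth (rev A) (rev A) + wealth (rev A) (rev F) ≡ wealth (rev F) (rev F) + wealth (rev F) (rev A)
    balanced = subst₂ (λ C B′ → wealth C C + wealth C B′ ≡ wealth B′ B′ + wealth B′ C) (sym revA) (sym (rev-flippedLast c m))
                      (wealth-self+cross-replicate≡ c m)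
    a≤b : a ≤ b
    a≤b = conway-odds≤ BA+a≡AA AB+b≡BB (≤-reflexive balanced)
    b≤a : b ≤ a
    b≤a = conway-odds≤ AB+b≡BB BA+a≡AA (≤-reflexive (sym balanced))

beaten-by-replicate : ∀ {m} (A : Vec Bool (suc (suc m))) c x t → rev A ≡ c ∷ x ∷ t →
  c ∷ x ∷ t ≢ replicate (suc (suc m)) c → ∃[ B ] (B ≢ A × ∃[ q ] (ProbBBeforeA A B q × q ℚ.< ½))
beaten-by-replicate {m} A c x t revA nonconstant = B , B≢A , _ , limit , a/1+s<½ a+b≡1+s (conway-odds< BA+a≡AA AB+b≡BB B-dominates)
  where
  B = Vec.replicate (suc (suc m)) c
  revB : rev B ≡ replicate (suc (suc m)) c
  revB = rev-replicate (suc (suc m)) c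
  B≢A : B ≢ A
  B≢A B≡A = nonconstant (trans (sym revA) (trans (cong rev (sym B≡A)) revB))
  open Odds (odds A B B≢A)
  |t|≡m : length t ≡ m
  |t|≡m = suc-injective (suc-injective (trans (cong length (sym revA)) (length-rev A)))
  B-dominates : wealth (rev A) (rev A) + wealth (rev A) (rev B) < wealth (rev B) (rev B) + wealth (rev B) (rev A)
  B-dominates = subst₂ (λ R C → wealth R R + wealth R C < wealth C C + wealth C R) (sym revA) (sym revB)
                       (wealth-self+cross<replicate c x t |t|≡m nonconstant)

constant-or-beaten : ∀ {m} (A : Vec Bool (suc (suc m))) →
  (A ≡ allH (suc (suc m)) ⊎ A ≡ allT (suc (suc m))) ⊎ ∃[ B ] (B ≢ A × ∃[ q ] (ProbBBeforeA A B q × q ℚ.< ½))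
constant-or-beaten {m} A = cases (rev A) refl
  where
  n = suc (suc m)
  cases : ∀ r → rev A ≡ r → (A ≡ allH n ⊎ A ≡ allT n) ⊎ ∃[ B ] (B ≢ A × ∃[ q ] (ProbBBeforeA A B q × q ℚ.< ½))
  cases [] revA = contradiction (trans (cong length (sym revA)) (length-rev A)) λ ()
  cases (_ ∷ []) revA = contradiction (trans (cong length (sym revA)) (length-rev A)) λ ()
  cases (c ∷ x ∷ t) revA with List.≡-dec Bool._≟_ (c ∷ x ∷ t) (replicate n c)
  ... | yes constant = inj₁ (allH-or-allT c (rev-injective (trans revA (trans constant (sym (rev-replicate n c))))))
    where
    allH-or-allT : ∀ c → A ≡ Vec.replicate n c → A ≡ allH n ⊎ A ≡ allT n
    allH-or-allT true = inj₁
    allH-or-allT false = inj₂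
  ... | no nonconstant = inj₂ (beaten-by-replicate A c x t revA nonconstant)

value≤½ : ∀ {m} {A : Vec Bool (suc (suc m))} {v} → Value A v → v ℚ.≤ ½
value≤½ {m} {A} val with constant-or-beaten A
... | inj₁ (inj₁ refl) = Value-≤ val (replicate-value (suc m) true)
... | inj₁ (inj₂ refl) = Value-≤ val (replicate-value (suc m) false)
... | inj₂ (B , B≢A , q , B→q , q<½) = ℚ.<⇒≤ (ℚ.≤-<-trans (proj₁ val B B≢A q B→q) q<½)

optimal⇔constant : ∀ {m} (A : Vec Bool (suc (suc m))) →
  IsOptimal (suc (suc m)) A ⇔ (A ≡ allH (suc (suc m)) ⊎ A ≡ allT (suc (suc m)))
optimal⇔constant {m} A = mk⇔ optimal⇒constant constant⇒optimal
  where
  constant⇒optimal : A ≡ allH (suc (suc m)) ⊎ A ≡ allT (suc (suc m)) → IsOptimal (suc (suc m)) A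
  constant⇒optimal (inj₁ refl) = ½ , replicate-value (suc m) true , λ _ _ → value≤½
  constant⇒optimal (inj₂ refl) = ½ , replicate-value (suc m) false , λ _ _ → value≤½
  optimal⇒constant : IsOptimal (suc (suc m)) A → A ≡ allH (suc (suc m)) ⊎ A ≡ allT (suc (suc m))
  optimal⇒constant (v , val , maximal) with constant-or-beaten A
  ... | inj₁ constant = constant
  ... | inj₂ (B , B≢A , q , B→q , q<½) =
    contradiction (ℚ.≤-<-trans (ℚ.≤-trans (maximal _ ½ (replicate-value (suc m) true)) (proj₁ val B B≢A q B→q)) q<½)
                  (ℚ.<-irrefl refl)

theorem1p4 : (n : ℕ) → 3 ≤ n →
    (∀ (A B : Vec Bool n) → B ≢ A → ∃[ q ] ProbBBeforeA A B q)
    × (∀ (A : Vec Bool n) → IsOptimal n A ⇔ (A ≡ allH n ⊎ A ≡ allT n))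
    × Value (allH n) ½
    × Value (allT n) ½
theorem1p4 (suc (suc (suc k))) (s≤s (s≤s (s≤s _))) =
    (λ A B B≢A → _ , Odds.limit (odds A B B≢A))
  , optimal⇔constant
  , replicate-value (suc (suc k)) true
  , replicate-value (suc (suc k)) false
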